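{- For every integer $n\ge0$, $$V_n=\sum_{k=0}^n\binom{n}{k}\binom{n+k}{k}(-16)^{n-k}G_k.$$
   Context: For $n\ge0$, $G_n=\sum_{k=0}^n \binom{2k}{k}^2\binom{2n-2k}{n-k}4^{n-k}$ and $V_n=\sum_{k=0}^n\binom{2k}{k}^2\binom{2n-2k}{n-k}^2$. -}

module Defs where

open import Data.Nat using (ℕ; zero; suc; _∸_)
open import Data.Nat.Combinatorics using (_C_)
open import Data.Integer using (ℤ; +_; -_; _+_; _*_; _^_)

sumTo : ℕ → (ℕ → ℤ) → ℤ
sumTo zero    f = f zero
sumTo (suc n) f = sumTo n f + f (suc n)

cb : ℕ → ℤ
cb k = + ((k Data.Nat.+ k) C k)

G : ℕ → ℤ
G n = sumTo n (λ k → cb k * cb k * cb (n ∸ k) * (+ 4) ^ (n ∸ k))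

V : ℕ → ℤ
V n = sumTo n (λ k → cb k * cb k * (cb (n ∸ k) * cb (n ∸ k)))

RHS : ℕ → ℤ
RHS n = sumTo n (λ k → + (n C k) * + ((n Data.Nat.+ k) C k) * (- (+ 16)) ^ (n ∸ k) * G k)

module Submission where

-- Both sides satisfy the recurrence PV, of order two with leading coefficient (n+2)³, and
-- they agree at n = 0 and n = 1.  For V this is Zeilberger's creative telescoping: the
-- summand is hypergeometric in n and k, and the rational certificate QV / XV turns
-- PV applied to the summand into a difference in k.  The same argument gives a recurrence
-- PG for G.  The right-hand side sums a hypergeometric term T n k against G k; applying
-- PV to it, the result telescopes against W n k = w₀ n k * G k + w₁ n k * G (1+k), once
-- G (2+k) is eliminated with the recurrence PG.  The certificates were found by
-- computer algebra; here they are only checked.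

open import Defs
open import Data.Nat as ℕ using (ℕ; zero; suc; _∸_; s≤s)
import Data.Nat.Properties as ℕP
open import Data.Nat.Combinatorics using (_C_; nCk+nC[k+1]≡[n+1]C[k+1]; nC1≡n)
open import Data.Integer using (ℤ; +_; -_; _+_; _*_; _-_; _^_; 0ℤ; 1ℤ; ∣_∣; ≢-nonZero)
import Data.Integer.Properties as ℤP
open import Data.Integer.Tactic.RingSolver using (solve-∀; solve)
open import Algebra.Properties.CommutativeSemigroup ℤP.+-commutativeSemigroup
  using () renaming (interchange to +-interchange)
open import Data.List using (_∷_; [])
open import Data.Sum using (inj₁; inj₂)
open import Data.Product using (_×_; _,_; proj₁)
open import Data.Empty using (⊥-elim)
open import Relation.Binary.PropositionalEquality
  using (_≡_; _≢_; refl; sym; trans; cong; cong₂; subst; module ≡-Reasoning)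

*-≢0 : ∀ {i j} → i ≢ 0ℤ → j ≢ 0ℤ → i * j ≢ 0ℤ
*-≢0 {i} i≢0 j≢0 ij≡0 with ℤP.i*j≡0⇒i≡0∨j≡0 i ij≡0
... | inj₁ i≡0 = i≢0 i≡0
... | inj₂ j≡0 = j≢0 j≡0

*-cancelˡ-≢0 : ∀ {d x y} → d ≢ 0ℤ → d * x ≡ d * y → x ≡ y
*-cancelˡ-≢0 {d} {x} {y} d≢0 = ℤP.*-cancelˡ-≡ d x y {{≢-nonZero d≢0}}

i*j≡0⇒j≡0 : ∀ {d} x → d ≢ 0ℤ → d * x ≡ 0ℤ → x ≡ 0ℤ
i*j≡0⇒j≡0 {d} x d≢0 dx≡0 with ℤP.i*j≡0⇒i≡0∨j≡0 d dx≡0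
... | inj₁ d≡0 = ⊥-elim (d≢0 d≡0)
... | inj₂ x≡0 = x≡0

+[1+n]≢0 : ∀ n → + suc n ≢ 0ℤ
+[1+n]≢0 n ()

2i+1≢0 : ∀ i → + 2 * i + 1ℤ ≢ 0ℤ
2i+1≢0 i 2i+1≡0 = 2≢1 (ℕP.m*n≡1⇒m≡1 2 ∣ - i ∣ (trans (sym (ℤP.abs-* (+ 2) (- i))) (cong ∣_∣ 2[-i]≡1)))
  where
  2≢1 : 2 ≢ 1
  2≢1 ()
  rearrange : ∀ i → + 2 * (- i) ≡ 1ℤ - (+ 2 * i + 1ℤ)
  rearrange = solve-∀
  2[-i]≡1 : + 2 * (- i) ≡ 1ℤ
  2[-i]≡1 = trans (rearrange i) (cong (λ x → 1ℤ - x) 2i+1≡0)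

2i-1≢0 : ∀ i → + 2 * i - 1ℤ ≢ 0ℤ
2i-1≢0 i = subst (_≢ 0ℤ) (shift i) (2i+1≢0 (i - 1ℤ))
  where
  shift : ∀ i → + 2 * (i - 1ℤ) + 1ℤ ≡ + 2 * i - 1ℤ
  shift = solve-∀

sumBelow : ℕ → (ℕ → ℤ) → ℤ
sumBelow zero    f = 0ℤ
sumBelow (suc K) f = sumBelow K f + f K

sumTo≡sumBelow : ∀ n f → sumTo n f ≡ sumBelow (suc n) f
sumTo≡sumBelow zero    f = sym (ℤP.+-identityˡ (f 0))
sumTo≡sumBelow (suc n) f = cong (_+ f (suc n)) (sumTo≡sumBelow n f)

sumBelow-cong : ∀ K {f g} → (∀ k → k ℕ.< K → f k ≡ g k) → sumBelow K f ≡ sumBelow K g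
sumBelow-cong zero    f≗g = refl
sumBelow-cong (suc K) f≗g =
  cong₂ _+_ (sumBelow-cong K (λ k k<K → f≗g k (ℕP.m<n⇒m<1+n k<K))) (f≗g K (ℕP.n<1+n K))

sumBelow-zeros : ∀ j K f → (∀ k → K ℕ.≤ k → f k ≡ 0ℤ) → sumBelow (j ℕ.+ K) f ≡ sumBelow K f
sumBelow-zeros zero    K f zeros = refl
sumBelow-zeros (suc j) K f zeros = begin
  sumBelow (j ℕ.+ K) f + f (j ℕ.+ K) ≡⟨ cong₂ _+_ (sumBelow-zeros j K f zeros) (zeros _ (ℕP.m≤n+m K j)) ⟩
  sumBelow K f + 0ℤ                  ≡⟨ ℤP.+-identityʳ _ ⟩
  sumBelow K f                       ∎
  where open ≡-Reasoning

sumBelow-+ : ∀ K f g → sumBelow K (λ k → f k + g k) ≡ sumBelow K f + sumBelow K g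
sumBelow-+ zero    f g = refl
sumBelow-+ (suc K) f g = begin
  sumBelow K (λ k → f k + g k) + (f K + g K)   ≡⟨ cong (_+ (f K + g K)) (sumBelow-+ K f g) ⟩
  sumBelow K f + sumBelow K g + (f K + g K)     ≡⟨ +-interchange (sumBelow K f) (sumBelow K g) (f K) (g K) ⟩
  sumBelow K f + f K + (sumBelow K g + g K)     ∎
  where open ≡-Reasoning

sumBelow-*ˡ : ∀ K c f → sumBelow K (λ k → c * f k) ≡ c * sumBelow K f
sumBelow-*ˡ zero    c f = sym (ℤP.*-zeroʳ c)
sumBelow-*ˡ (suc K) c f = begin
  sumBelow K (λ k → c * f k) + c * f K  ≡⟨ cong (_+ c * f K) (sumBelow-*ˡ K c f) ⟩
  c * sumBelow K f + c * f K            ≡⟨ ℤP.*-distribˡ-+ c (sumBelow K f) (f K) ⟨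
  c * (sumBelow K f + f K)              ∎
  where open ≡-Reasoning

sumBelow-telescope : ∀ (Z s : ℕ → ℤ) → (∀ k → s k ≡ Z (suc k) - Z k) → ∀ K → sumBelow K s ≡ Z K - Z 0
sumBelow-telescope Z s step zero    = sym (ℤP.+-inverseʳ (Z 0))
sumBelow-telescope Z s step (suc K) = begin
  sumBelow K s + s K                   ≡⟨ cong₂ _+_ (sumBelow-telescope Z s step K) (step K) ⟩
  Z K - Z 0 + (Z (suc K) - Z K)        ≡⟨ solve-telescope (Z 0) (Z K) (Z (suc K)) ⟩
  Z (suc K) - Z 0                      ∎
  where
  open ≡-Reasoning
  solve-telescope : ∀ a b c → b - a + (c - b) ≡ c - a
  solve-telescope = solve-∀

-- Telescoping of the fractions Z k / X k, kept free of division.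
sumBelow-telescope-fraction : ∀ (X Z s : ℕ → ℤ) → (∀ k → X k ≢ 0ℤ) → Z 0 ≡ 0ℤ →
  (∀ k → X k * X (suc k) * s k ≡ X k * Z (suc k) - X (suc k) * Z k) →
  ∀ K → X K * sumBelow K s ≡ Z K
sumBelow-telescope-fraction X Z s X≢0 Z₀≡0 step zero    = trans (ℤP.*-zeroʳ (X 0)) (sym Z₀≡0)
sumBelow-telescope-fraction X Z s X≢0 Z₀≡0 step (suc K) = *-cancelˡ-≢0 (X≢0 K) (begin
  X K * (X (suc K) * (sumBelow K s + s K))             ≡⟨ expand (X K) (X (suc K)) (sumBelow K s) (s K) ⟩
  X (suc K) * (X K * sumBelow K s) + X K * X (suc K) * s K
    ≡⟨ cong₂ (λ u v → X (suc K) * u + v) (sumBelow-telescope-fraction X Z s X≢0 Z₀≡0 step K) (step K) ⟩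
  X (suc K) * Z K + (X K * Z (suc K) - X (suc K) * Z K) ≡⟨ cancel (X (suc K) * Z K) (X K * Z (suc K)) ⟩
  X K * Z (suc K)                                       ∎)
  where
  open ≡-Reasoning
  expand : ∀ a b c d → a * (b * (c + d)) ≡ b * (a * c) + a * b * d
  expand = solve-∀
  cancel : ∀ a b → a + (b - a) ≡ b
  cancel = solve-∀

record Recurrence : Set where
  constructor recurrence
  field p₀ p₁ p₂ : ℕ → ℤ

_Annihilates_ : Recurrence → (ℕ → ℤ) → Set
P Annihilates u = ∀ n → p₀ n * u n + p₁ n * u (suc n) + p₂ n * u (suc (suc n)) ≡ 0ℤ
  where open Recurrence P

annihilates-resp : ∀ P {u v : ℕ → ℤ} → (∀ n → u n ≡ v n) → P Annihilates u → P Annihilates v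
annihilates-resp P {u} {v} u≗v Pu n = begin
  p₀ n * v n + p₁ n * v (suc n) + p₂ n * v (suc (suc n))
    ≡⟨ cong₂ (λ x y → p₀ n * x + p₁ n * y + p₂ n * v (suc (suc n))) (sym (u≗v n)) (sym (u≗v (suc n))) ⟩
  p₀ n * u n + p₁ n * u (suc n) + p₂ n * v (suc (suc n))
    ≡⟨ cong (λ z → p₀ n * u n + p₁ n * u (suc n) + p₂ n * z) (sym (u≗v (suc (suc n)))) ⟩
  p₀ n * u n + p₁ n * u (suc n) + p₂ n * u (suc (suc n))
    ≡⟨ Pu n ⟩
  0ℤ ∎
  where
  open Recurrence P
  open ≡-Reasoning

annihilated-unique : ∀ P {u v : ℕ → ℤ} → (∀ n → Recurrence.p₂ P n ≢ 0ℤ) →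
  P Annihilates u → P Annihilates v → u 0 ≡ v 0 → u 1 ≡ v 1 → ∀ n → u n ≡ v n
annihilated-unique P {u} {v} p₂≢0 Pu Pv u₀≡v₀ u₁≡v₁ n = proj₁ (agree n)
  where
  open Recurrence P
  open ≡-Reasoning
  isolate : ∀ a b c → c ≡ a + b + c - (a + b)
  isolate = solve-∀
  last-term : ∀ (w : ℕ → ℤ) → P Annihilates w → ∀ n →
    p₂ n * w (suc (suc n)) ≡ 0ℤ - (p₀ n * w n + p₁ n * w (suc n))
  last-term w Pw n = trans (isolate (p₀ n * w n) (p₁ n * w (suc n)) _) (cong (_- (p₀ n * w n + p₁ n * w (suc n))) (Pw n))
  agree : ∀ n → u n ≡ v n × u (suc n) ≡ v (suc n)
  agree zero    = u₀≡v₀ , u₁≡v₁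
  agree (suc n) with agree n
  ... | uₙ≡vₙ , uₙ₊₁≡vₙ₊₁ = uₙ₊₁≡vₙ₊₁ , *-cancelˡ-≢0 (p₂≢0 n) (begin
    p₂ n * u (suc (suc n))                         ≡⟨ last-term u Pu n ⟩
    0ℤ - (p₀ n * u n + p₁ n * u (suc n))           ≡⟨ cong₂ (λ x y → 0ℤ - (p₀ n * x + p₁ n * y)) uₙ≡vₙ uₙ₊₁≡vₙ₊₁ ⟩
    0ℤ - (p₀ n * v n + p₁ n * v (suc n))           ≡⟨ last-term v Pv n ⟨
    p₂ n * v (suc (suc n))                         ∎)

annihilates-sum : ∀ P (F : ℕ → ℕ → ℤ) → (∀ n k → n ℕ.< k → F n k ≡ 0ℤ) →
  (∀ n → let open Recurrence P in
         sumBelow (3 ℕ.+ n) (λ k → p₀ n * F n k + p₁ n * F (suc n) k + p₂ n * F (2 ℕ.+ n) k) ≡ 0ℤ) →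
  P Annihilates (λ n → sumBelow (suc n) (F n))
annihilates-sum P F above combination n = begin
  p₀ n * Σ (suc n) (F n) + p₁ n * Σ (2 ℕ.+ n) (F (suc n)) + p₂ n * Σ K (F (2 ℕ.+ n))
    ≡⟨ cong₂ (λ x y → p₀ n * x + p₁ n * y + p₂ n * Σ K (F (2 ℕ.+ n)))
             (sumBelow-zeros 2 (suc n) (F n) (above n)) (sumBelow-zeros 1 (2 ℕ.+ n) (F (suc n)) (above (suc n))) ⟨
  p₀ n * Σ K (F n) + p₁ n * Σ K (F (suc n)) + p₂ n * Σ K (F (2 ℕ.+ n))
    ≡⟨ cong₂ (λ x y → x + y + p₂ n * Σ K (F (2 ℕ.+ n))) (sumBelow-*ˡ K (p₀ n) (F n)) (sumBelow-*ˡ K (p₁ n) (F (suc n))) ⟨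
  Σ K (λ k → p₀ n * F n k) + Σ K (λ k → p₁ n * F (suc n) k) + p₂ n * Σ K (F (2 ℕ.+ n))
    ≡⟨ cong₂ _+_ (sumBelow-+ K _ _) (sumBelow-*ˡ K (p₂ n) (F (2 ℕ.+ n))) ⟨
  Σ K (λ k → p₀ n * F n k + p₁ n * F (suc n) k) + Σ K (λ k → p₂ n * F (2 ℕ.+ n) k)
    ≡⟨ sumBelow-+ K _ _ ⟨
  Σ K (λ k → p₀ n * F n k + p₁ n * F (suc n) k + p₂ n * F (2 ℕ.+ n) k)
    ≡⟨ combination n ⟩
  0ℤ ∎
  where
  open Recurrence P
  open ≡-Reasoning
  Σ = sumBelow
  K = 3 ℕ.+ n

-- The two conditions say that the coefficients of G k and G (1+k) in
-- p₂ k * (W (1+k) - W k - s k * G k), where W k = w₀ k * G k + w₁ k * G (1+k),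
-- vanish once G (2+k) is eliminated with the recurrence.
telescoping-against : ∀ R {G : ℕ → ℤ} → R Annihilates G → (∀ k → Recurrence.p₂ R k ≢ 0ℤ) →
  ∀ (w₀ w₁ s : ℕ → ℤ) → let open Recurrence R in
  (∀ k → p₂ k * (w₀ k + s k) + p₀ k * w₁ (suc k) ≡ 0ℤ) →
  (∀ k → p₂ k * (w₀ (suc k) - w₁ k) - p₁ k * w₁ (suc k) ≡ 0ℤ) →
  ∀ k → s k * G k ≡ (w₀ (suc k) * G (suc k) + w₁ (suc k) * G (suc (suc k))) - (w₀ k * G k + w₁ k * G (suc k))
telescoping-against R {G} RG p₂≢0 w₀ w₁ s coefficient₀ coefficient₁ k =
  sym (ℤP.i-j≡0⇒i≡j _ _ (i*j≡0⇒j≡0 _ (p₂≢0 k) (begin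
    p₂ k * (w₀ (suc k) * G (suc k) + w₁ (suc k) * G (suc (suc k)) - (w₀ k * G k + w₁ k * G (suc k)) - s k * G k)
      ≡⟨ regroup (p₀ k) (p₁ k) (p₂ k) (w₀ k) (w₀ (suc k)) (w₁ k) (w₁ (suc k)) (s k) (G k) (G (suc k)) (G (suc (suc k))) ⟩
    G (suc k) * (p₂ k * (w₀ (suc k) - w₁ k) - p₁ k * w₁ (suc k)) - G k * (p₂ k * (w₀ k + s k) + p₀ k * w₁ (suc k))
      + w₁ (suc k) * (p₀ k * G k + p₁ k * G (suc k) + p₂ k * G (suc (suc k)))
      ≡⟨ cong₂ _+_ (cong₂ (λ x y → G (suc k) * x - G k * y) (coefficient₁ k) (coefficient₀ k))
                   (cong (w₁ (suc k) *_) (RG k)) ⟩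
    G (suc k) * 0ℤ - G k * 0ℤ + w₁ (suc k) * 0ℤ
      ≡⟨ vanish (G (suc k)) (G k) (w₁ (suc k)) ⟩
    0ℤ ∎)))
  where
  open Recurrence R
  open ≡-Reasoning
  regroup : ∀ p₀ p₁ p₂ w₀ w₀′ w₁ w₁′ s g₀ g₁ g₂ →
    p₂ * (w₀′ * g₁ + w₁′ * g₂ - (w₀ * g₀ + w₁ * g₁) - s * g₀)
      ≡ g₁ * (p₂ * (w₀′ - w₁) - p₁ * w₁′) - g₀ * (p₂ * (w₀ + s) + p₀ * w₁′) + w₁′ * (p₀ * g₀ + p₁ * g₁ + p₂ * g₂)
  regroup = solve-∀
  vanish : ∀ x y z → x * 0ℤ - y * 0ℤ + z * 0ℤ ≡ 0ℤ
  vanish = solve-∀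

-- Summands are given as f k m at n = k + m, so that no truncated subtraction enters the
-- algebra; triangle f n k is f k (n - k) for k ≤ n and 0 above the diagonal.
triangle : (ℕ → ℕ → ℤ) → ℕ → ℕ → ℤ
triangle f n       zero    = f zero n
triangle f zero    (suc k) = 0ℤ
triangle f (suc n) (suc k) = triangle (λ i → f (suc i)) n k

triangle-≤ : ∀ f {n k} → k ℕ.≤ n → triangle f n k ≡ f k (n ∸ k)
triangle-≤ f {n}     {zero}  _         = refl
triangle-≤ f {suc n} {suc k} (s≤s k≤n) = triangle-≤ (λ i → f (suc i)) k≤n

triangle-above : ∀ f {n k} → n ℕ.< k → triangle f n k ≡ 0ℤ
triangle-above f {zero}  {suc k} _         = refl
triangle-above f {suc n} {suc k} (s≤s n<k) = triangle-above (λ i → f (suc i)) n<k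

sumTo≡sumBelow-triangle : ∀ f n → sumTo n (λ k → f k (n ∸ k)) ≡ sumBelow (suc n) (triangle f n)
sumTo≡sumBelow-triangle f n =
  trans (sumTo≡sumBelow n _) (sumBelow-cong (suc n) (λ k k<1+n → sym (triangle-≤ f (ℕP.≤-pred k<1+n))))

triangle-shiftₙ : ∀ (a b f : ℕ → ℕ → ℤ) →
  (∀ k m → a (k ℕ.+ m) k * f k m ≡ b (k ℕ.+ m) k * f k (suc m)) →
  (∀ n → b n (suc n) ≡ 0ℤ) →
  ∀ n k → a n k * triangle f n k ≡ b n k * triangle f (suc n) k
triangle-shiftₙ a b f step edge n       zero          = step 0 n
triangle-shiftₙ a b f step edge zero    (suc zero)    =
  trans (ℤP.*-zeroʳ (a 0 1)) (sym (trans (cong (_* f 1 0) (edge 0)) (ℤP.*-zeroˡ (f 1 0))))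
triangle-shiftₙ a b f step edge zero    (suc (suc k)) =
  trans (ℤP.*-zeroʳ (a 0 (2 ℕ.+ k))) (sym (ℤP.*-zeroʳ (b 0 (2 ℕ.+ k))))
triangle-shiftₙ a b f step edge (suc n) (suc k)       =
  triangle-shiftₙ (λ n k → a (suc n) (suc k)) (λ n k → b (suc n) (suc k)) (λ i → f (suc i))
                  (λ k → step (suc k)) (λ n → edge (suc n)) n k

triangle-shiftₖ : ∀ (c d f : ℕ → ℕ → ℤ) →
  (∀ k m → c (k ℕ.+ suc m) k * f (suc k) m ≡ d (k ℕ.+ suc m) k * f k (suc m)) →
  (∀ k → d k k ≡ 0ℤ) →
  ∀ n k → c n k * triangle f n (suc k) ≡ d n k * triangle f n k
triangle-shiftₖ c d f step diagonal zero    zero    =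
  trans (ℤP.*-zeroʳ (c 0 0)) (sym (trans (cong (_* f 0 0) (diagonal 0)) (ℤP.*-zeroˡ (f 0 0))))
triangle-shiftₖ c d f step diagonal zero    (suc k) =
  trans (ℤP.*-zeroʳ (c 0 (suc k))) (sym (ℤP.*-zeroʳ (d 0 (suc k))))
triangle-shiftₖ c d f step diagonal (suc n) zero    = step 0 n
triangle-shiftₖ c d f step diagonal (suc n) (suc k) =
  triangle-shiftₖ (λ n k → c (suc n) (suc k)) (λ n k → d (suc n) (suc k)) (λ i → f (suc i))
                  (λ k → step (suc k)) (λ k → diagonal (suc k)) n k

record Hypergeometric (F : ℕ → ℕ → ℤ) : Set where
  field
    a b c d : ℕ → ℕ → ℤ
    shiftₙ  : ∀ n k → a n k * F n k ≡ b n k * F (suc n) k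
    shiftₖ  : ∀ n k → c n k * F n (suc k) ≡ d n k * F n k
    a≢0     : ∀ n k → a n k ≢ 0ℤ
    c≢0     : ∀ n k → c n k ≢ 0ℤ

-- Creative telescoping

ratio-trans : ∀ δ₁ ν₁ δ₂ ν₂ x y z → δ₁ * x ≡ ν₁ * y → δ₂ * y ≡ ν₂ * z → δ₂ * δ₁ * x ≡ ν₁ * ν₂ * z
ratio-trans δ₁ ν₁ δ₂ ν₂ x y z h₁ h₂ = begin
  δ₂ * δ₁ * x     ≡⟨ ℤP.*-assoc δ₂ δ₁ x ⟩
  δ₂ * (δ₁ * x)   ≡⟨ cong (δ₂ *_) h₁ ⟩
  δ₂ * (ν₁ * y)   ≡⟨ swap δ₂ ν₁ y ⟩
  ν₁ * (δ₂ * y)   ≡⟨ cong (ν₁ *_) h₂ ⟩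
  ν₁ * (ν₂ * z)   ≡⟨ ℤP.*-assoc ν₁ ν₂ z ⟨
  ν₁ * ν₂ * z     ∎
  where
  open ≡-Reasoning
  swap : ∀ a b c → a * (b * c) ≡ b * (a * c)
  swap = solve-∀

clear-denominators₅ : ∀ κ₁ κ₂ κ₃ κ₄ κ₅ δ₁ δ₂ δ₃ δ₄ δ₅ ν₁ ν₂ ν₃ ν₄ ν₅ t₁ t₂ t₃ t₄ t₅ e →
  δ₁ * t₁ ≡ ν₁ * e → δ₂ * t₂ ≡ ν₂ * e → δ₃ * t₃ ≡ ν₃ * e → δ₄ * t₄ ≡ ν₄ * e → δ₅ * t₅ ≡ ν₅ * e →
  δ₁ * δ₂ * δ₃ * δ₄ * δ₅ ≢ 0ℤ →
  κ₁ * ν₁ * δ₂ * δ₃ * δ₄ * δ₅ + κ₂ * ν₂ * δ₁ * δ₃ * δ₄ * δ₅ + κ₃ * ν₃ * δ₁ * δ₂ * δ₄ * δ₅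
    + κ₄ * ν₄ * δ₁ * δ₂ * δ₃ * δ₅ + κ₅ * ν₅ * δ₁ * δ₂ * δ₃ * δ₄ ≡ 0ℤ →
  κ₁ * t₁ + κ₂ * t₂ + κ₃ * t₃ + κ₄ * t₄ + κ₅ * t₅ ≡ 0ℤ
clear-denominators₅ κ₁ κ₂ κ₃ κ₄ κ₅ δ₁ δ₂ δ₃ δ₄ δ₅ ν₁ ν₂ ν₃ ν₄ ν₅ t₁ t₂ t₃ t₄ t₅ e h₁ h₂ h₃ h₄ h₅ D≢0 core≡0 =
  i*j≡0⇒j≡0 (κ₁ * t₁ + κ₂ * t₂ + κ₃ * t₃ + κ₄ * t₄ + κ₅ * t₅) D≢0 (begin
    δ₁ * δ₂ * δ₃ * δ₄ * δ₅ * (κ₁ * t₁ + κ₂ * t₂ + κ₃ * t₃ + κ₄ * t₄ + κ₅ * t₅)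
      ≡⟨ expand κ₁ κ₂ κ₃ κ₄ κ₅ δ₁ δ₂ δ₃ δ₄ δ₅ t₁ t₂ t₃ t₄ t₅ ⟩
    κ₁ * δ₂ * δ₃ * δ₄ * δ₅ * (δ₁ * t₁) + κ₂ * δ₁ * δ₃ * δ₄ * δ₅ * (δ₂ * t₂) + κ₃ * δ₁ * δ₂ * δ₄ * δ₅ * (δ₃ * t₃)
      + κ₄ * δ₁ * δ₂ * δ₃ * δ₅ * (δ₄ * t₄) + κ₅ * δ₁ * δ₂ * δ₃ * δ₄ * (δ₅ * t₅)
      ≡⟨ cong₂ _+_ (cong₂ _+_ (cong₂ _+_ (cong₂ _+_ (cong (κ₁ * δ₂ * δ₃ * δ₄ * δ₅ *_) h₁)
                                                    (cong (κ₂ * δ₁ * δ₃ * δ₄ * δ₅ *_) h₂))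
                                        (cong (κ₃ * δ₁ * δ₂ * δ₄ * δ₅ *_) h₃))
                             (cong (κ₄ * δ₁ * δ₂ * δ₃ * δ₅ *_) h₄))
                  (cong (κ₅ * δ₁ * δ₂ * δ₃ * δ₄ *_) h₅) ⟩
    κ₁ * δ₂ * δ₃ * δ₄ * δ₅ * (ν₁ * e) + κ₂ * δ₁ * δ₃ * δ₄ * δ₅ * (ν₂ * e) + κ₃ * δ₁ * δ₂ * δ₄ * δ₅ * (ν₃ * e)
      + κ₄ * δ₁ * δ₂ * δ₃ * δ₅ * (ν₄ * e) + κ₅ * δ₁ * δ₂ * δ₃ * δ₄ * (ν₅ * e)
      ≡⟨ collect κ₁ κ₂ κ₃ κ₄ κ₅ δ₁ δ₂ δ₃ δ₄ δ₅ ν₁ ν₂ ν₃ ν₄ ν₅ e ⟩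
    (κ₁ * ν₁ * δ₂ * δ₃ * δ₄ * δ₅ + κ₂ * ν₂ * δ₁ * δ₃ * δ₄ * δ₅ + κ₃ * ν₃ * δ₁ * δ₂ * δ₄ * δ₅
      + κ₄ * ν₄ * δ₁ * δ₂ * δ₃ * δ₅ + κ₅ * ν₅ * δ₁ * δ₂ * δ₃ * δ₄) * e
      ≡⟨ cong (_* e) core≡0 ⟩
    0ℤ * e
      ≡⟨ ℤP.*-zeroˡ e ⟩
    0ℤ ∎)
  where
  open ≡-Reasoning
  expand : ∀ κ₁ κ₂ κ₃ κ₄ κ₅ δ₁ δ₂ δ₃ δ₄ δ₅ t₁ t₂ t₃ t₄ t₅ →
    δ₁ * δ₂ * δ₃ * δ₄ * δ₅ * (κ₁ * t₁ + κ₂ * t₂ + κ₃ * t₃ + κ₄ * t₄ + κ₅ * t₅)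
      ≡ κ₁ * δ₂ * δ₃ * δ₄ * δ₅ * (δ₁ * t₁) + κ₂ * δ₁ * δ₃ * δ₄ * δ₅ * (δ₂ * t₂) + κ₃ * δ₁ * δ₂ * δ₄ * δ₅ * (δ₃ * t₃)
        + κ₄ * δ₁ * δ₂ * δ₃ * δ₅ * (δ₄ * t₄) + κ₅ * δ₁ * δ₂ * δ₃ * δ₄ * (δ₅ * t₅)
  expand = solve-∀
  collect : ∀ κ₁ κ₂ κ₃ κ₄ κ₅ δ₁ δ₂ δ₃ δ₄ δ₅ ν₁ ν₂ ν₃ ν₄ ν₅ e →
    κ₁ * δ₂ * δ₃ * δ₄ * δ₅ * (ν₁ * e) + κ₂ * δ₁ * δ₃ * δ₄ * δ₅ * (ν₂ * e) + κ₃ * δ₁ * δ₂ * δ₄ * δ₅ * (ν₃ * e)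
      + κ₄ * δ₁ * δ₂ * δ₃ * δ₅ * (ν₄ * e) + κ₅ * δ₁ * δ₂ * δ₃ * δ₄ * (ν₅ * e)
      ≡ (κ₁ * ν₁ * δ₂ * δ₃ * δ₄ * δ₅ + κ₂ * ν₂ * δ₁ * δ₃ * δ₄ * δ₅ + κ₃ * ν₃ * δ₁ * δ₂ * δ₄ * δ₅
         + κ₄ * ν₄ * δ₁ * δ₂ * δ₃ * δ₅ + κ₅ * ν₅ * δ₁ * δ₂ * δ₃ * δ₄) * e
  collect = solve-∀

module Zeilberger {F : ℕ → ℕ → ℤ} (H : Hypergeometric F) (P : Recurrence) (X Q : ℕ → ℕ → ℤ) where
  open Hypergeometric H
  open Recurrence P

  -- The telescoping relation below, multiplied by a n k * a (1+n) k * c (2+n) k and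
  -- with every term rewritten as a multiple of F (2+n) k.
  Certificate : Set
  Certificate = ∀ n k →
    let a₀ = a n k ; a₁ = a (suc n) k ; b₀ = b n k ; b₁ = b (suc n) k
        c₂ = c (2 ℕ.+ n) k ; d₂ = d (2 ℕ.+ n) k
        X₀ = X n k ; X₁ = X n (suc k) ; Q₀ = Q n k ; Q₁ = Q n (suc k)
    in X₀ * X₁ * (p₀ n * b₀ * b₁ * c₂ + p₁ n * a₀ * b₁ * c₂ + p₂ n * a₀ * a₁ * c₂)
       - X₀ * Q₁ * a₀ * a₁ * d₂ + X₁ * Q₀ * a₀ * a₁ * c₂ ≡ 0ℤ

  telescoping : Certificate → ∀ n k →
    X n k * X n (suc k) * (p₀ n * F n k + p₁ n * F (suc n) k + p₂ n * F (2 ℕ.+ n) k)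
      ≡ X n k * (Q n (suc k) * F (2 ℕ.+ n) (suc k)) - X n (suc k) * (Q n k * F (2 ℕ.+ n) k)
  telescoping certificate n k = ℤP.i-j≡0⇒i≡j _ _ (i*j≡0⇒j≡0 _ D≢0 (clear-denominators
    (a n k) (a (suc n) k) (b n k) (b (suc n) k) (c (2 ℕ.+ n) k) (d (2 ℕ.+ n) k)
    (X n k) (X n (suc k)) (Q n k) (Q n (suc k)) (p₀ n) (p₁ n) (p₂ n)
    (F n k) (F (suc n) k) (F (2 ℕ.+ n) k) (F (2 ℕ.+ n) (suc k))
    (shiftₙ n k) (shiftₙ (suc n) k) (shiftₖ (2 ℕ.+ n) k) (certificate n k)))
    where
    D≢0 = *-≢0 (*-≢0 (a≢0 n k) (a≢0 (suc n) k)) (c≢0 (2 ℕ.+ n) k)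
    rearrange : ∀ a₀ a₁ b₀ b₁ c₂ d₂ X₀ X₁ Q₀ Q₁ p₀ p₁ p₂ e₀ e₁ e₂ e₃ →
      let core = X₀ * X₁ * (p₀ * b₀ * b₁ * c₂ + p₁ * a₀ * b₁ * c₂ + p₂ * a₀ * a₁ * c₂)
                 - X₀ * Q₁ * a₀ * a₁ * d₂ + X₁ * Q₀ * a₀ * a₁ * c₂
      in a₀ * a₁ * c₂ * (X₀ * X₁ * (p₀ * e₀ + p₁ * e₁ + p₂ * e₂) - (X₀ * (Q₁ * e₃) - X₁ * (Q₀ * e₂)))
         ≡ X₀ * X₁ * p₀ * a₁ * c₂ * (a₀ * e₀ - b₀ * e₁)
           + X₀ * X₁ * (p₀ * b₀ * c₂ + p₁ * a₀ * c₂) * (a₁ * e₁ - b₁ * e₂)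
           - X₀ * Q₁ * a₀ * a₁ * (c₂ * e₃ - d₂ * e₂) + core * e₂
    rearrange = solve-∀
    vanish : ∀ κ₀ κ₁ κ₃ e → κ₀ * 0ℤ + κ₁ * 0ℤ - κ₃ * 0ℤ + 0ℤ * e ≡ 0ℤ
    vanish = solve-∀
    clear-denominators : ∀ a₀ a₁ b₀ b₁ c₂ d₂ X₀ X₁ Q₀ Q₁ p₀ p₁ p₂ e₀ e₁ e₂ e₃ →
      a₀ * e₀ ≡ b₀ * e₁ → a₁ * e₁ ≡ b₁ * e₂ → c₂ * e₃ ≡ d₂ * e₂ →
      X₀ * X₁ * (p₀ * b₀ * b₁ * c₂ + p₁ * a₀ * b₁ * c₂ + p₂ * a₀ * a₁ * c₂)
        - X₀ * Q₁ * a₀ * a₁ * d₂ + X₁ * Q₀ * a₀ * a₁ * c₂ ≡ 0ℤ →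
      a₀ * a₁ * c₂ * (X₀ * X₁ * (p₀ * e₀ + p₁ * e₁ + p₂ * e₂) - (X₀ * (Q₁ * e₃) - X₁ * (Q₀ * e₂))) ≡ 0ℤ
    clear-denominators a₀ a₁ b₀ b₁ c₂ d₂ X₀ X₁ Q₀ Q₁ p₀ p₁ p₂ e₀ e₁ e₂ e₃ h₀ h₁ h₃ core≡0 =
      trans (rearrange a₀ a₁ b₀ b₁ c₂ d₂ X₀ X₁ Q₀ Q₁ p₀ p₁ p₂ e₀ e₁ e₂ e₃)
        (trans (cong₂ _+_ (cong₂ _-_ (cong₂ _+_ (cong (X₀ * X₁ * p₀ * a₁ * c₂ *_) (ℤP.i≡j⇒i-j≡0 h₀))
                                                (cong (X₀ * X₁ * (p₀ * b₀ * c₂ + p₁ * a₀ * c₂) *_) (ℤP.i≡j⇒i-j≡0 h₁)))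
                                     (cong (X₀ * Q₁ * a₀ * a₁ *_) (ℤP.i≡j⇒i-j≡0 h₃)))
                          (cong (_* e₂) core≡0))
               (vanish (X₀ * X₁ * p₀ * a₁ * c₂) (X₀ * X₁ * (p₀ * b₀ * c₂ + p₁ * a₀ * c₂)) (X₀ * Q₁ * a₀ * a₁) e₂))

  annihilates : (∀ n k → n ℕ.< k → F n k ≡ 0ℤ) → (∀ n k → X n k ≢ 0ℤ) → (∀ n → Q n 0 ≡ 0ℤ) →
    Certificate → P Annihilates (λ n → sumBelow (suc n) (F n))
  annihilates above X≢0 Q₀≡0 certificate = annihilates-sum P F above λ n →
    i*j≡0⇒j≡0 (sumBelow (3 ℕ.+ n) (combination n)) (X≢0 n (3 ℕ.+ n)) (begin
      X n (3 ℕ.+ n) * sumBelow (3 ℕ.+ n) (combination n)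
        ≡⟨ sumBelow-telescope-fraction (X n) (λ k → Q n k * F (2 ℕ.+ n) k) (combination n) (X≢0 n)
             (trans (cong (_* F (2 ℕ.+ n) 0) (Q₀≡0 n)) (ℤP.*-zeroˡ (F (2 ℕ.+ n) 0))) (telescoping certificate n) (3 ℕ.+ n) ⟩
      Q n (3 ℕ.+ n) * F (2 ℕ.+ n) (3 ℕ.+ n)
        ≡⟨ cong (Q n (3 ℕ.+ n) *_) (above (2 ℕ.+ n) (3 ℕ.+ n) (ℕP.n<1+n _)) ⟩
      Q n (3 ℕ.+ n) * 0ℤ
        ≡⟨ ℤP.*-zeroʳ (Q n (3 ℕ.+ n)) ⟩
      0ℤ ∎)
    where
    open ≡-Reasoning
    combination : ℕ → ℕ → ℤ
    combination n k = p₀ n * F n k + p₁ n * F (suc n) k + p₂ n * F (2 ℕ.+ n) k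

[k+1]*[n+1]C[k+1]≡[n+1]*nCk : ∀ n k → suc k ℕ.* (suc n C suc k) ≡ suc n ℕ.* (n C k)
[k+1]*[n+1]C[k+1]≡[n+1]*nCk zero    zero    = refl
[k+1]*[n+1]C[k+1]≡[n+1]*nCk zero    (suc k) = ℕP.*-zeroʳ (2 ℕ.+ k)
[k+1]*[n+1]C[k+1]≡[n+1]*nCk (suc n) zero    =
  trans (ℕP.*-identityˡ _) (trans (nC1≡n (2 ℕ.+ n)) (sym (ℕP.*-identityʳ (2 ℕ.+ n))))
[k+1]*[n+1]C[k+1]≡[n+1]*nCk (suc n) (suc k) = begin
  (2 ℕ.+ k) ℕ.* ((2 ℕ.+ n) C (2 ℕ.+ k))
    ≡⟨ cong ((2 ℕ.+ k) ℕ.*_) (nCk+nC[k+1]≡[n+1]C[k+1] (suc n) (suc k)) ⟨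
  (2 ℕ.+ k) ℕ.* (suc n C suc k ℕ.+ suc n C (2 ℕ.+ k))
    ≡⟨ split (suc n C suc k) (suc n C (2 ℕ.+ k)) k ⟩
  suc n C suc k ℕ.+ (suc k ℕ.* (suc n C suc k) ℕ.+ (2 ℕ.+ k) ℕ.* (suc n C (2 ℕ.+ k)))
    ≡⟨ cong₂ (λ x y → suc n C suc k ℕ.+ (x ℕ.+ y))
             ([k+1]*[n+1]C[k+1]≡[n+1]*nCk n k) ([k+1]*[n+1]C[k+1]≡[n+1]*nCk n (suc k)) ⟩
  suc n C suc k ℕ.+ (suc n ℕ.* (n C k) ℕ.+ suc n ℕ.* (n C suc k))
    ≡⟨ cong (suc n C suc k ℕ.+_) (ℕP.*-distribˡ-+ (suc n) (n C k) (n C suc k)) ⟨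
  suc n C suc k ℕ.+ suc n ℕ.* (n C k ℕ.+ n C suc k)
    ≡⟨ cong (λ x → suc n C suc k ℕ.+ suc n ℕ.* x) (nCk+nC[k+1]≡[n+1]C[k+1] n k) ⟩
  (2 ℕ.+ n) ℕ.* (suc n C suc k) ∎
  where
  open ≡-Reasoning
  open import Data.Nat.Tactic.RingSolver using () renaming (solve-∀ to solve-ℕ)
  split : ∀ x y k → (2 ℕ.+ k) ℕ.* (x ℕ.+ y) ≡ x ℕ.+ (suc k ℕ.* x ℕ.+ (2 ℕ.+ k) ℕ.* y)
  split = solve-ℕ

binom-absorption : ∀ n k → (1ℤ + + k) * + (suc n C suc k) ≡ (1ℤ + + n) * + (n C k)
binom-absorption n k =
  trans (sym (ℤP.pos-* (suc k) _)) (trans (cong +_ ([k+1]*[n+1]C[k+1]≡[n+1]*nCk n k)) (ℤP.pos-* (suc n) _))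

binom-pascal : ∀ n k → + (suc n C suc k) ≡ + (n C k) + + (n C suc k)
binom-pascal n k = cong +_ (sym (nCk+nC[k+1]≡[n+1]C[k+1] n k))

binom-lower : ∀ n k → (1ℤ + + k) * + (n C suc k) ≡ (+ n - + k) * + (n C k)
binom-lower n k = begin
  (1ℤ + K) * + (n C suc k)                          ≡⟨ complete K (+ (n C k)) (+ (n C suc k)) ⟩
  (1ℤ + K) * (+ (n C k) + + (n C suc k)) - (1ℤ + K) * + (n C k)
    ≡⟨ cong (λ x → (1ℤ + K) * x - (1ℤ + K) * + (n C k)) (binom-pascal n k) ⟨
  (1ℤ + K) * + (suc n C suc k) - (1ℤ + K) * + (n C k)
    ≡⟨ cong (_- (1ℤ + K) * + (n C k)) (binom-absorption n k) ⟩
  (1ℤ + + n) * + (n C k) - (1ℤ + K) * + (n C k)     ≡⟨ collect (+ n) K (+ (n C k)) ⟩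
  (+ n - K) * + (n C k)                             ∎
  where
  open ≡-Reasoning
  K = + k
  complete : ∀ K x y → (1ℤ + K) * y ≡ (1ℤ + K) * (x + y) - (1ℤ + K) * x
  complete = solve-∀
  collect : ∀ N K x → (1ℤ + N) * x - (1ℤ + K) * x ≡ (N - K) * x
  collect = solve-∀

binom-upper : ∀ n k → (1ℤ + + n - + k) * + (suc n C k) ≡ (1ℤ + + n) * + (n C k)
binom-upper n zero    = cong (_* 1ℤ) (ℤP.+-identityʳ (1ℤ + + n))
binom-upper n (suc j) = begin
  (1ℤ + N - (1ℤ + J)) * + (suc n C suc j)                 ≡⟨ cong ((1ℤ + N - (1ℤ + J)) *_) (binom-pascal n j) ⟩
  (1ℤ + N - (1ℤ + J)) * (+ (n C j) + + (n C suc j))       ≡⟨ expand N J (+ (n C j)) (+ (n C suc j)) ⟩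
  (N - J) * + (n C j) + (N - J) * + (n C suc j)            ≡⟨ cong (_+ (N - J) * + (n C suc j)) (binom-lower n j) ⟨
  (1ℤ + J) * + (n C suc j) + (N - J) * + (n C suc j)       ≡⟨ collect N J (+ (n C suc j)) ⟩
  (1ℤ + N) * + (n C suc j)                                 ∎
  where
  open ≡-Reasoning
  N = + n
  J = + j
  expand : ∀ N J x y → (1ℤ + N - (1ℤ + J)) * (x + y) ≡ (N - J) * x + (N - J) * y
  expand = solve-∀
  collect : ∀ N J y → (1ℤ + J) * y + (N - J) * y ≡ (1ℤ + N) * y
  collect = solve-∀

central-suc : ∀ m → (1ℤ + + m) * cb (suc m) ≡ + 2 * (+ 2 * + m + 1ℤ) * cb m
central-suc m = *-cancelˡ-≢0 {1ℤ + M} (λ ()) (begin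
  (1ℤ + M) * ((1ℤ + M) * cb (suc m))
    ≡⟨ cong (λ x → (1ℤ + M) * ((1ℤ + M) * + (x C suc m))) (cong suc (ℕP.+-suc m m)) ⟩
  (1ℤ + M) * ((1ℤ + M) * + (suc (suc (m ℕ.+ m)) C suc m))
    ≡⟨ cong ((1ℤ + M) *_) (binom-absorption (suc (m ℕ.+ m)) m) ⟩
  (1ℤ + M) * ((1ℤ + (1ℤ + (M + M))) * c)              ≡⟨ regroup M c ⟩
  (+ 2 + + 2 * M) * ((1ℤ + (M + M) - M) * c)          ≡⟨ cong ((+ 2 + + 2 * M) *_) (binom-upper (m ℕ.+ m) m) ⟩
  (+ 2 + + 2 * M) * ((1ℤ + (M + M)) * cb m)           ≡⟨ regroup′ M (cb m) ⟩
  (1ℤ + M) * (+ 2 * (+ 2 * M + 1ℤ) * cb m)            ∎)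
  where
  open ≡-Reasoning
  M = + m
  c = + (suc (m ℕ.+ m) C m)
  regroup : ∀ M c → (1ℤ + M) * ((1ℤ + (1ℤ + (M + M))) * c) ≡ (+ 2 + + 2 * M) * ((1ℤ + (M + M) - M) * c)
  regroup = solve-∀
  regroup′ : ∀ M b → (+ 2 + + 2 * M) * ((1ℤ + (M + M)) * b) ≡ (1ℤ + M) * (+ 2 * (+ 2 * M + 1ℤ) * b)
  regroup′ = solve-∀

1+n-[1+n]≡0 : ∀ n → 1ℤ + + n - + suc n ≡ 0ℤ
1+n-[1+n]≡0 n = ℤP.+-inverseʳ (1ℤ + + n)

-- The recurrence of V

vTerm : ℕ → ℕ → ℤ
vTerm k m = cb k * cb k * (cb m * cb m)

aV bV cV dV : ℕ → ℕ → ℤ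
aV n k = + 4 * (+ 2 * (+ n - + k) + 1ℤ) * (+ 2 * (+ n - + k) + 1ℤ)
bV n k = (1ℤ + + n - + k) * (1ℤ + + n - + k)
cV n k = + 4 * (1ℤ + + k) * (1ℤ + + k) * (+ 2 * (+ n - + k) - 1ℤ) * (+ 2 * (+ n - + k) - 1ℤ)
dV n k = + 4 * (+ 2 * + k + 1ℤ) * (+ 2 * + k + 1ℤ) * (+ n - + k) * (+ n - + k)

V-hypergeometric : Hypergeometric (triangle vTerm)
V-hypergeometric = record
  { a = aV ; b = bV ; c = cV ; d = dV
  ; shiftₙ = triangle-shiftₙ aV bV vTerm (λ k m → stepₙ (+ k) (+ m) (cb k) (cb m) (cb (suc m)) (central-suc m)) edge
  ; shiftₖ = triangle-shiftₖ cV dV vTerm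
               (λ k m → stepₖ (+ k) (+ m) (cb k) (cb (suc k)) (cb m) (cb (suc m)) (central-suc k) (central-suc m)) diagonal
  ; a≢0 = λ n k → *-≢0 (*-≢0 (+[1+n]≢0 3) (2i+1≢0 (+ n - + k))) (2i+1≢0 (+ n - + k))
  ; c≢0 = λ n k → *-≢0 (*-≢0 (*-≢0 (*-≢0 (+[1+n]≢0 3) (+[1+n]≢0 k)) (+[1+n]≢0 k)) (2i-1≢0 (+ n - + k))) (2i-1≢0 (+ n - + k))
  }
  where
  open ≡-Reasoning
  stepₙ : ∀ K M x y y′ → (1ℤ + M) * y′ ≡ + 2 * (+ 2 * M + 1ℤ) * y →
    + 4 * (+ 2 * (K + M - K) + 1ℤ) * (+ 2 * (K + M - K) + 1ℤ) * (x * x * (y * y))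
      ≡ (1ℤ + (K + M) - K) * (1ℤ + (K + M) - K) * (x * x * (y′ * y′))
  stepₙ K M x y y′ h = begin
    + 4 * (+ 2 * (K + M - K) + 1ℤ) * (+ 2 * (K + M - K) + 1ℤ) * (x * x * (y * y))
      ≡⟨ solve (K ∷ M ∷ x ∷ y ∷ []) ⟩
    x * x * (+ 2 * (+ 2 * M + 1ℤ) * y * (+ 2 * (+ 2 * M + 1ℤ) * y))
      ≡⟨ cong (λ z → x * x * (z * z)) h ⟨
    x * x * ((1ℤ + M) * y′ * ((1ℤ + M) * y′))
      ≡⟨ solve (K ∷ M ∷ x ∷ y′ ∷ []) ⟩
    (1ℤ + (K + M) - K) * (1ℤ + (K + M) - K) * (x * x * (y′ * y′)) ∎
  stepₖ : ∀ K M x x′ y y′ → (1ℤ + K) * x′ ≡ + 2 * (+ 2 * K + 1ℤ) * x → (1ℤ + M) * y′ ≡ + 2 * (+ 2 * M + 1ℤ) * y →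
    + 4 * (1ℤ + K) * (1ℤ + K) * (+ 2 * (K + (1ℤ + M) - K) - 1ℤ) * (+ 2 * (K + (1ℤ + M) - K) - 1ℤ) * (x′ * x′ * (y * y))
      ≡ + 4 * (+ 2 * K + 1ℤ) * (+ 2 * K + 1ℤ) * (K + (1ℤ + M) - K) * (K + (1ℤ + M) - K) * (x * x * (y′ * y′))
  stepₖ K M x x′ y y′ hₖ hₘ = begin
    + 4 * (1ℤ + K) * (1ℤ + K) * (+ 2 * (K + (1ℤ + M) - K) - 1ℤ) * (+ 2 * (K + (1ℤ + M) - K) - 1ℤ) * (x′ * x′ * (y * y))
      ≡⟨ solve (K ∷ M ∷ x′ ∷ y ∷ []) ⟩
    + 4 * (+ 2 * M + 1ℤ) * (+ 2 * M + 1ℤ) * ((1ℤ + K) * x′ * ((1ℤ + K) * x′)) * (y * y)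
      ≡⟨ cong (λ z → + 4 * (+ 2 * M + 1ℤ) * (+ 2 * M + 1ℤ) * (z * z) * (y * y)) hₖ ⟩
    + 4 * (+ 2 * M + 1ℤ) * (+ 2 * M + 1ℤ) * (+ 2 * (+ 2 * K + 1ℤ) * x * (+ 2 * (+ 2 * K + 1ℤ) * x)) * (y * y)
      ≡⟨ solve (K ∷ M ∷ x ∷ y ∷ []) ⟩
    + 4 * (+ 2 * K + 1ℤ) * (+ 2 * K + 1ℤ) * (x * x) * (+ 2 * (+ 2 * M + 1ℤ) * y * (+ 2 * (+ 2 * M + 1ℤ) * y))
      ≡⟨ cong (λ z → + 4 * (+ 2 * K + 1ℤ) * (+ 2 * K + 1ℤ) * (x * x) * (z * z)) hₘ ⟨
    + 4 * (+ 2 * K + 1ℤ) * (+ 2 * K + 1ℤ) * (x * x) * ((1ℤ + M) * y′ * ((1ℤ + M) * y′))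
      ≡⟨ solve (K ∷ M ∷ x ∷ y′ ∷ []) ⟩
    + 4 * (+ 2 * K + 1ℤ) * (+ 2 * K + 1ℤ) * (K + (1ℤ + M) - K) * (K + (1ℤ + M) - K) * (x * x * (y′ * y′)) ∎
  edge : ∀ n → bV n (suc n) ≡ 0ℤ
  edge n rewrite 1+n-[1+n]≡0 n = refl
  diagonal : ∀ k → dV k k ≡ 0ℤ
  diagonal k rewrite ℤP.+-inverseʳ (+ k) = ℤP.*-zeroʳ (+ 4 * (+ 2 * + k + 1ℤ) * (+ 2 * + k + 1ℤ) * 0ℤ)

PV : Recurrence
PV = recurrence (λ n → + 256 * (1ℤ + + n) * (1ℤ + + n) * (1ℤ + + n))
                (λ n → - (+ 8 * (+ 2 * + n + + 3) * (+ 2 * + n * + n + + 6 * + n + + 5)))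
                (λ n → (+ 2 + + n) * (+ 2 + + n) * (+ 2 + + n))

XV QV : ℕ → ℕ → ℤ
XV n k = + 4 * (+ 2 * K - 1ℤ) * (+ 2 * K - 1ℤ) * (+ 2 * (1ℤ + N - K) + 1ℤ) * (+ 2 * (1ℤ + N - K) + 1ℤ)
  where N = + n ; K = + k
QV n k = K * K * (+ 40 - + 184 * K + + 256 * K * K - + 96 * K * K * K
                  + N * (+ 52 - + 224 * K + + 272 * K * K - + 64 * K * K * K)
                  + N * N * (+ 16 - + 64 * K + + 64 * K * K))
  where N = + n ; K = + k

V-certificate : ∀ N K →
  let a₀ = + 4 * (+ 2 * (N - K) + 1ℤ) * (+ 2 * (N - K) + 1ℤ)
      a₁ = + 4 * (+ 2 * (1ℤ + N - K) + 1ℤ) * (+ 2 * (1ℤ + N - K) + 1ℤ)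
      b₀ = (1ℤ + N - K) * (1ℤ + N - K)
      b₁ = (1ℤ + (1ℤ + N) - K) * (1ℤ + (1ℤ + N) - K)
      c₂ = + 4 * (1ℤ + K) * (1ℤ + K) * (+ 2 * (+ 2 + N - K) - 1ℤ) * (+ 2 * (+ 2 + N - K) - 1ℤ)
      d₂ = + 4 * (+ 2 * K + 1ℤ) * (+ 2 * K + 1ℤ) * (+ 2 + N - K) * (+ 2 + N - K)
      X₀ = + 4 * (+ 2 * K - 1ℤ) * (+ 2 * K - 1ℤ) * (+ 2 * (1ℤ + N - K) + 1ℤ) * (+ 2 * (1ℤ + N - K) + 1ℤ)
      X₁ = + 4 * (+ 2 * (1ℤ + K) - 1ℤ) * (+ 2 * (1ℤ + K) - 1ℤ)
             * (+ 2 * (1ℤ + N - (1ℤ + K)) + 1ℤ) * (+ 2 * (1ℤ + N - (1ℤ + K)) + 1ℤ)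
      Q₀ = K * K * (+ 40 - + 184 * K + + 256 * K * K - + 96 * K * K * K
                    + N * (+ 52 - + 224 * K + + 272 * K * K - + 64 * K * K * K)
                    + N * N * (+ 16 - + 64 * K + + 64 * K * K))
      K′ = 1ℤ + K
      Q₁ = K′ * K′ * (+ 40 - + 184 * K′ + + 256 * K′ * K′ - + 96 * K′ * K′ * K′
                      + N * (+ 52 - + 224 * K′ + + 272 * K′ * K′ - + 64 * K′ * K′ * K′)
                      + N * N * (+ 16 - + 64 * K′ + + 64 * K′ * K′))
      p₀ = + 256 * (1ℤ + N) * (1ℤ + N) * (1ℤ + N)
      p₁ = - (+ 8 * (+ 2 * N + + 3) * (+ 2 * N * N + + 6 * N + + 5))
      p₂ = (+ 2 + N) * (+ 2 + N) * (+ 2 + N)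
  in X₀ * X₁ * (p₀ * b₀ * b₁ * c₂ + p₁ * a₀ * b₁ * c₂ + p₂ * a₀ * a₁ * c₂)
     - X₀ * Q₁ * a₀ * a₁ * d₂ + X₁ * Q₀ * a₀ * a₁ * c₂ ≡ 0ℤ
V-certificate = solve-∀

V-annihilated : PV Annihilates V
V-annihilated = annihilates-resp PV (λ n → sym (sumTo≡sumBelow-triangle vTerm n))
  (annihilates (λ n k n<k → triangle-above vTerm n<k) XV≢0 (λ n → refl) (λ n k → V-certificate (+ n) (+ k)))
  where
  open Zeilberger V-hypergeometric PV XV QV
  XV≢0 : ∀ n k → XV n k ≢ 0ℤ
  XV≢0 n k = *-≢0 (*-≢0 (*-≢0 (*-≢0 (+[1+n]≢0 3) (2i-1≢0 (+ k))) (2i-1≢0 (+ k))) (2i+1≢0 (1ℤ + + n - + k)))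
                  (2i+1≢0 (1ℤ + + n - + k))

-- The recurrence of G

gTerm : ℕ → ℕ → ℤ
gTerm k m = cb k * cb k * cb m * (+ 4) ^ m

aG bG cG dG : ℕ → ℕ → ℤ
aG n k = + 8 * (+ 2 * (+ n - + k) + 1ℤ)
bG n k = 1ℤ + + n - + k
cG n k = + 8 * (1ℤ + + k) * (1ℤ + + k) * (+ 2 * (+ n - + k) - 1ℤ)
dG n k = + 4 * (+ 2 * + k + 1ℤ) * (+ 2 * + k + 1ℤ) * (+ n - + k)

G-hypergeometric : Hypergeometric (triangle gTerm)
G-hypergeometric = record
  { a = aG ; b = bG ; c = cG ; d = dG
  ; shiftₙ = triangle-shiftₙ aG bG gTerm
               (λ k m → stepₙ (+ k) (+ m) (cb k) (cb m) (cb (suc m)) ((+ 4) ^ m) (central-suc m)) 1+n-[1+n]≡0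
  ; shiftₖ = triangle-shiftₖ cG dG gTerm
               (λ k m → stepₖ (+ k) (+ m) (cb k) (cb (suc k)) (cb m) (cb (suc m)) ((+ 4) ^ m)
                              (central-suc k) (central-suc m))
               diagonal
  ; a≢0 = λ n k → *-≢0 (+[1+n]≢0 7) (2i+1≢0 (+ n - + k))
  ; c≢0 = λ n k → *-≢0 (*-≢0 (*-≢0 (+[1+n]≢0 7) (+[1+n]≢0 k)) (+[1+n]≢0 k)) (2i-1≢0 (+ n - + k))
  }
  where
  open ≡-Reasoning
  stepₙ : ∀ K M x y y′ p → (1ℤ + M) * y′ ≡ + 2 * (+ 2 * M + 1ℤ) * y →
    + 8 * (+ 2 * (K + M - K) + 1ℤ) * (x * x * y * p) ≡ (1ℤ + (K + M) - K) * (x * x * y′ * (+ 4 * p))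
  stepₙ K M x y y′ p h = begin
    + 8 * (+ 2 * (K + M - K) + 1ℤ) * (x * x * y * p)  ≡⟨ solve (K ∷ M ∷ x ∷ y ∷ p ∷ []) ⟩
    + 4 * x * x * p * (+ 2 * (+ 2 * M + 1ℤ) * y)      ≡⟨ cong (+ 4 * x * x * p *_) h ⟨
    + 4 * x * x * p * ((1ℤ + M) * y′)                 ≡⟨ solve (K ∷ M ∷ x ∷ y′ ∷ p ∷ []) ⟩
    (1ℤ + (K + M) - K) * (x * x * y′ * (+ 4 * p))     ∎
  stepₖ : ∀ K M x x′ y y′ p → (1ℤ + K) * x′ ≡ + 2 * (+ 2 * K + 1ℤ) * x → (1ℤ + M) * y′ ≡ + 2 * (+ 2 * M + 1ℤ) * y →
    + 8 * (1ℤ + K) * (1ℤ + K) * (+ 2 * (K + (1ℤ + M) - K) - 1ℤ) * (x′ * x′ * y * p)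
      ≡ + 4 * (+ 2 * K + 1ℤ) * (+ 2 * K + 1ℤ) * (K + (1ℤ + M) - K) * (x * x * y′ * (+ 4 * p))
  stepₖ K M x x′ y y′ p hₖ hₘ = begin
    + 8 * (1ℤ + K) * (1ℤ + K) * (+ 2 * (K + (1ℤ + M) - K) - 1ℤ) * (x′ * x′ * y * p)
      ≡⟨ solve (K ∷ M ∷ x′ ∷ y ∷ p ∷ []) ⟩
    + 8 * (+ 2 * M + 1ℤ) * y * p * ((1ℤ + K) * x′ * ((1ℤ + K) * x′))
      ≡⟨ cong (λ z → + 8 * (+ 2 * M + 1ℤ) * y * p * (z * z)) hₖ ⟩
    + 8 * (+ 2 * M + 1ℤ) * y * p * (+ 2 * (+ 2 * K + 1ℤ) * x * (+ 2 * (+ 2 * K + 1ℤ) * x))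
      ≡⟨ solve (K ∷ M ∷ x ∷ y ∷ p ∷ []) ⟩
    + 16 * (+ 2 * K + 1ℤ) * (+ 2 * K + 1ℤ) * x * x * p * (+ 2 * (+ 2 * M + 1ℤ) * y)
      ≡⟨ cong (+ 16 * (+ 2 * K + 1ℤ) * (+ 2 * K + 1ℤ) * x * x * p *_) hₘ ⟨
    + 16 * (+ 2 * K + 1ℤ) * (+ 2 * K + 1ℤ) * x * x * p * ((1ℤ + M) * y′)
      ≡⟨ solve (K ∷ M ∷ x ∷ y′ ∷ p ∷ []) ⟩
    + 4 * (+ 2 * K + 1ℤ) * (+ 2 * K + 1ℤ) * (K + (1ℤ + M) - K) * (x * x * y′ * (+ 4 * p)) ∎
  diagonal : ∀ k → dG k k ≡ 0ℤ
  diagonal k rewrite ℤP.+-inverseʳ (+ k) = ℤP.*-zeroʳ (+ 4 * (+ 2 * + k + 1ℤ) * (+ 2 * + k + 1ℤ))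

PG : Recurrence
PG = recurrence (λ n → + 256 * (1ℤ + + n) * (1ℤ + + n))
                (λ n → - (+ 4 * (+ 8 * + n * + n + + 24 * + n + + 19)))
                (λ n → (+ 2 + + n) * (+ 2 + + n))

XG QG : ℕ → ℕ → ℤ
XG n k = + 2 * (1ℤ + + n - + k) + 1ℤ
QG n k = + k * + k

G-certificate : ∀ N K →
  let a₀ = + 8 * (+ 2 * (N - K) + 1ℤ)
      a₁ = + 8 * (+ 2 * (1ℤ + N - K) + 1ℤ)
      b₀ = 1ℤ + N - K
      b₁ = 1ℤ + (1ℤ + N) - K
      c₂ = + 8 * (1ℤ + K) * (1ℤ + K) * (+ 2 * (+ 2 + N - K) - 1ℤ)
      d₂ = + 4 * (+ 2 * K + 1ℤ) * (+ 2 * K + 1ℤ) * (+ 2 + N - K)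
      X₀ = + 2 * (1ℤ + N - K) + 1ℤ
      X₁ = + 2 * (1ℤ + N - (1ℤ + K)) + 1ℤ
      Q₀ = K * K
      Q₁ = (1ℤ + K) * (1ℤ + K)
      p₀ = + 256 * (1ℤ + N) * (1ℤ + N)
      p₁ = - (+ 4 * (+ 8 * N * N + + 24 * N + + 19))
      p₂ = (+ 2 + N) * (+ 2 + N)
  in X₀ * X₁ * (p₀ * b₀ * b₁ * c₂ + p₁ * a₀ * b₁ * c₂ + p₂ * a₀ * a₁ * c₂)
     - X₀ * Q₁ * a₀ * a₁ * d₂ + X₁ * Q₀ * a₀ * a₁ * c₂ ≡ 0ℤ
G-certificate = solve-∀

G-annihilated : PG Annihilates G
G-annihilated = annihilates-resp PG (λ n → sym (sumTo≡sumBelow-triangle gTerm n))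
  (annihilates (λ n k n<k → triangle-above gTerm n<k) (λ n k → 2i+1≢0 (1ℤ + + n - + k)) (λ n → refl)
               (λ n k → G-certificate (+ n) (+ k)))
  where open Zeilberger G-hypergeometric PG XG QG

-- The recurrence of the right-hand side

tTerm : ℕ → ℕ → ℤ
tTerm k m = + ((k ℕ.+ m) C k) * + ((k ℕ.+ m ℕ.+ k) C k) * (- (+ 16)) ^ m

aT bT cT dT : ℕ → ℕ → ℤ
aT n k = - (+ 16) * (1ℤ + + n + + k)
bT n k = 1ℤ + + n - + k
cT n k = + 16 * (1ℤ + + k) * (1ℤ + + k)
dT n k = - ((+ n - + k) * (1ℤ + + n + + k))

T-hypergeometric : Hypergeometric (triangle tTerm)
T-hypergeometric = record
  { a = aT ; b = bT ; c = cT ; d = dT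
  ; shiftₙ = triangle-shiftₙ aT bT tTerm shiftₙ 1+n-[1+n]≡0
  ; shiftₖ = triangle-shiftₖ cT dT tTerm shiftₖ diagonal
  ; a≢0 = λ n k → *-≢0 -16≢0 (+[1+n]≢0 (n ℕ.+ k))
  ; c≢0 = λ n k → *-≢0 (*-≢0 (+[1+n]≢0 15) (+[1+n]≢0 k)) (+[1+n]≢0 k)
  }
  where
  open ≡-Reasoning
  -16≢0 : - (+ 16) ≢ 0ℤ
  -16≢0 ()
  stepₙ : ∀ K N x x′ y y′ p → (1ℤ + N - K) * x′ ≡ (1ℤ + N) * x → (1ℤ + (N + K) - K) * y′ ≡ (1ℤ + (N + K)) * y →
    - (+ 16) * (1ℤ + N + K) * (x * y * p) ≡ (1ℤ + N - K) * (x′ * y′ * (- (+ 16) * p))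
  stepₙ K N x x′ y y′ p hₓ hᵧ = begin
    - (+ 16) * (1ℤ + N + K) * (x * y * p)       ≡⟨ solve (K ∷ N ∷ x ∷ y ∷ p ∷ []) ⟩
    - (+ 16) * p * x * ((1ℤ + (N + K)) * y)     ≡⟨ cong (- (+ 16) * p * x *_) hᵧ ⟨
    - (+ 16) * p * x * ((1ℤ + (N + K) - K) * y′) ≡⟨ solve (K ∷ N ∷ x ∷ y′ ∷ p ∷ []) ⟩
    - (+ 16) * p * y′ * ((1ℤ + N) * x)          ≡⟨ cong (- (+ 16) * p * y′ *_) hₓ ⟨
    - (+ 16) * p * y′ * ((1ℤ + N - K) * x′)     ≡⟨ solve (K ∷ N ∷ x′ ∷ y′ ∷ p ∷ []) ⟩
    (1ℤ + N - K) * (x′ * y′ * (- (+ 16) * p))   ∎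
  shiftₙ : ∀ k m → aT (k ℕ.+ m) k * tTerm k m ≡ bT (k ℕ.+ m) k * tTerm k (suc m)
  shiftₙ k m rewrite ℕP.+-suc k m =
    stepₙ (+ k) (+ (k ℕ.+ m)) _ _ _ _ ((- (+ 16)) ^ m) (binom-upper (k ℕ.+ m) k) (binom-upper (k ℕ.+ m ℕ.+ k) k)
  stepₖ : ∀ K M x₀ x₁ y₀ y₁ p → (1ℤ + K) * x₁ ≡ (1ℤ + (K + M) - K) * x₀ →
    (1ℤ + K) * y₁ ≡ (1ℤ + (1ℤ + (K + M + K))) * y₀ →
    + 16 * (1ℤ + K) * (1ℤ + K) * (x₁ * y₁ * p)
      ≡ - ((1ℤ + (K + M) - K) * (1ℤ + (1ℤ + (K + M)) + K)) * (x₀ * y₀ * (- (+ 16) * p))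
  stepₖ K M x₀ x₁ y₀ y₁ p hₓ hᵧ = begin
    + 16 * (1ℤ + K) * (1ℤ + K) * (x₁ * y₁ * p)                  ≡⟨ solve (K ∷ M ∷ x₁ ∷ y₁ ∷ p ∷ []) ⟩
    + 16 * p * ((1ℤ + K) * x₁) * ((1ℤ + K) * y₁)                ≡⟨ cong₂ (λ u v → + 16 * p * u * v) hₓ hᵧ ⟩
    + 16 * p * ((1ℤ + (K + M) - K) * x₀) * ((1ℤ + (1ℤ + (K + M + K))) * y₀)
      ≡⟨ solve (K ∷ M ∷ x₀ ∷ y₀ ∷ p ∷ []) ⟩
    - ((1ℤ + (K + M) - K) * (1ℤ + (1ℤ + (K + M)) + K)) * (x₀ * y₀ * (- (+ 16) * p)) ∎
  shiftₖ : ∀ k m → cT (k ℕ.+ suc m) k * tTerm (suc k) m ≡ dT (k ℕ.+ suc m) k * tTerm k (suc m)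
  shiftₖ k m rewrite ℕP.+-suc k m | ℕP.+-suc (k ℕ.+ m) k =
    stepₖ (+ k) (+ m) _ _ _ _ ((- (+ 16)) ^ m) (binom-lower (suc (k ℕ.+ m)) k) (binom-absorption (suc (k ℕ.+ m ℕ.+ k)) k)
  diagonal : ∀ k → dT k k ≡ 0ℤ
  diagonal k rewrite ℤP.+-inverseʳ (+ k) = refl

T-certificate : ∀ N K →
  let a₀ = - (+ 16) * (1ℤ + N + K)
      a₁ = - (+ 16) * (1ℤ + (1ℤ + N) + K)
      b₀ = 1ℤ + N - K
      b₁ = 1ℤ + (1ℤ + N) - K
      c  = + 16 * (1ℤ + K) * (1ℤ + K)
      c′ = + 16 * (1ℤ + (1ℤ + K)) * (1ℤ + (1ℤ + K))
      d₀ = - ((N - K) * (1ℤ + N + K))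
      d₁ = - ((1ℤ + N - K) * (1ℤ + (1ℤ + N) + K))
      d₂ = - ((+ 2 + N - K) * (1ℤ + (+ 2 + N) + K))
      d₁′ = - ((1ℤ + N - (1ℤ + K)) * (1ℤ + (1ℤ + N) + (1ℤ + K)))
      -- t = (ν / δ) * T (2+n) k for t = T (1+n) k, T (2+n) (1+k), T (1+n) (1+k), T n (1+k), T (1+n) (2+k)
      δ₁ = a₁ ; ν₁ = b₁
      δ₂ = c ; ν₂ = d₂
      δ₃ = a₁ * c ; ν₃ = d₁ * b₁
      δ₄ = a₁ * (a₀ * c) ; ν₄ = d₀ * b₀ * b₁
      δ₅ = a₁ * c * c′ ; ν₅ = d₁′ * (d₁ * b₁)
      p₀ = + 256 * (1ℤ + N) * (1ℤ + N) * (1ℤ + N)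
      p₁ = - (+ 8 * (+ 2 * N + + 3) * (+ 2 * N * N + + 6 * N + + 5))
      p₂ = (+ 2 + N) * (+ 2 + N) * (+ 2 + N)
      g₁ = - (+ 4 * (+ 8 * K * K + + 24 * K + + 19))
      g₂ = (+ 2 + K) * (+ 2 + K)
      m₀ = - (+ 2 * (+ 2 * N + + 3) * (1ℤ + K) * (1ℤ + K))
      m₁ = - (+ 2 * (+ 2 * N + + 3) * (1ℤ + (1ℤ + K)) * (1ℤ + (1ℤ + K)))
      r₁ = + 512 * (+ 2 * N + + 3) * (1ℤ + (1ℤ + K)) * (1ℤ + (1ℤ + K))
      κ₁ = - (g₂ * m₀) ; κ₂ = - (g₂ * p₂) ; κ₃ = - (g₂ * p₁) - g₁ * m₁ ; κ₄ = - (g₂ * p₀) ; κ₅ = g₂ * r₁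
  in κ₁ * ν₁ * δ₂ * δ₃ * δ₄ * δ₅ + κ₂ * ν₂ * δ₁ * δ₃ * δ₄ * δ₅ + κ₃ * ν₃ * δ₁ * δ₂ * δ₄ * δ₅
       + κ₄ * ν₄ * δ₁ * δ₂ * δ₃ * δ₅ + κ₅ * ν₅ * δ₁ * δ₂ * δ₃ * δ₄ ≡ 0ℤ
T-certificate = solve-∀

module RightHandSide where
  open Hypergeometric T-hypergeometric
  open Recurrence PV
  open Recurrence PG using () renaming (p₀ to g₀; p₁ to g₁; p₂ to g₂)
  open ≡-Reasoning

  T : ℕ → ℕ → ℤ
  T = triangle tTerm

  -- m is the certificate; r is then forced by coefficient₀.
  m r s w₀ w₁ W : ℕ → ℕ → ℤ
  m n k = - (+ 2 * (+ 2 * + n + + 3) * (1ℤ + + k) * (1ℤ + + k))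
  r n k = + 512 * (+ 2 * + n + + 3) * (1ℤ + + k) * (1ℤ + + k)
  s n k = p₀ n * T n k + p₁ n * T (suc n) k + p₂ n * T (2 ℕ.+ n) k
  w₁ n k = m n k * T (suc n) k
  w₀ n k = - s n k + r n k * T (suc n) (suc k)
  W n k = w₀ n k * G k + w₁ n k * G (suc k)

  coefficient₀ : ∀ n k → g₂ k * (w₀ n k + s n k) + g₀ k * w₁ n (suc k) ≡ 0ℤ
  coefficient₀ n k = cancel (+ n) (+ k) (s n k) (T (suc n) (suc k))
    where
    cancel : ∀ N K σ t →
      (+ 2 + K) * (+ 2 + K) * (- σ + + 512 * (+ 2 * N + + 3) * (1ℤ + K) * (1ℤ + K) * t + σ)
        + + 256 * (1ℤ + K) * (1ℤ + K) * (- (+ 2 * (+ 2 * N + + 3) * (1ℤ + (1ℤ + K)) * (1ℤ + (1ℤ + K))) * t) ≡ 0ℤ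
    cancel = solve-∀

  coefficient₁ : ∀ n k → g₂ k * (w₀ n (suc k) - w₁ n k) - g₁ k * w₁ n (suc k) ≡ 0ℤ
  coefficient₁ n k = trans (regroup (g₁ k) (g₂ k) (p₀ n) (p₁ n) (p₂ n) (r n (suc k)) (m n k) (m n (suc k)) t₁ t₂ t₃ t₄ t₅)
    (clear-denominators₅ κ₁ κ₂ κ₃ κ₄ κ₅ δ₁ δ₂ δ₃ δ₄ δ₅ ν₁ ν₂ ν₃ ν₄ ν₅ t₁ t₂ t₃ t₄ t₅ e h₁ h₂ h₃ h₄ h₅
      (*-≢0 (*-≢0 (*-≢0 (*-≢0 a₁≢0 c≢0′) (*-≢0 a₁≢0 c≢0′)) (*-≢0 a₁≢0 (*-≢0 (a≢0 n k) c≢0′)))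
            (*-≢0 (*-≢0 a₁≢0 c≢0′) (c≢0 (suc n) (suc k))))
      (T-certificate (+ n) (+ k)))
    where
    e  = T (2 ℕ.+ n) k
    t₁ = T (suc n) k
    t₂ = T (2 ℕ.+ n) (suc k)
    t₃ = T (suc n) (suc k)
    t₄ = T n (suc k)
    t₅ = T (suc n) (2 ℕ.+ k)
    a₁≢0 = a≢0 (suc n) k
    κ₁ = - (g₂ k * m n k)
    κ₂ = - (g₂ k * p₂ n)
    κ₃ = - (g₂ k * p₁ n) - g₁ k * m n (suc k)
    κ₄ = - (g₂ k * p₀ n)
    κ₅ = g₂ k * r n (suc k)
    c≢0′ = c≢0 n k
    δ₁ = a (suc n) k
    ν₁ = b (suc n) k
    δ₂ = c (2 ℕ.+ n) k
    ν₂ = d (2 ℕ.+ n) k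
    δ₃ = a (suc n) k * c (suc n) k
    ν₃ = d (suc n) k * b (suc n) k
    δ₄ = a (suc n) k * (a n k * c n k)
    ν₄ = d n k * b n k * b (suc n) k
    δ₅ = a (suc n) k * c (suc n) k * c (suc n) (suc k)
    ν₅ = d (suc n) (suc k) * (d (suc n) k * b (suc n) k)
    h₁ : δ₁ * t₁ ≡ ν₁ * e
    h₁ = shiftₙ (suc n) k
    h₂ : δ₂ * t₂ ≡ ν₂ * e
    h₂ = shiftₖ (2 ℕ.+ n) k
    h₃ : δ₃ * t₃ ≡ ν₃ * e
    h₃ = ratio-trans (c (suc n) k) (d (suc n) k) (a (suc n) k) (b (suc n) k) t₃ t₁ e (shiftₖ (suc n) k) h₁
    h₄ : δ₄ * t₄ ≡ ν₄ * e
    h₄ = ratio-trans (a n k * c n k) (d n k * b n k) (a (suc n) k) (b (suc n) k) t₄ t₁ e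
           (ratio-trans (c n k) (d n k) (a n k) (b n k) t₄ (T n k) t₁ (shiftₖ n k) (shiftₙ n k)) h₁
    h₅ : δ₅ * t₅ ≡ ν₅ * e
    h₅ = ratio-trans (c (suc n) (suc k)) (d (suc n) (suc k)) δ₃ ν₃ t₅ t₃ e (shiftₖ (suc n) (suc k)) h₃
    regroup : ∀ g₁ g₂ p₀ p₁ p₂ r₁ m₀ m₁ t₁ t₂ t₃ t₄ t₅ →
      g₂ * (- (p₀ * t₄ + p₁ * t₃ + p₂ * t₂) + r₁ * t₅ - m₀ * t₁) - g₁ * (m₁ * t₃)
        ≡ - (g₂ * m₀) * t₁ + - (g₂ * p₂) * t₂ + (- (g₂ * p₁) - g₁ * m₁) * t₃ + - (g₂ * p₀) * t₄ + g₂ * r₁ * t₅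
    regroup = solve-∀

  -- Uses T n 0 = (-16) ^ n, T (1+n) 1 = (1+n) (2+n) (-16) ^ n, G 0 = 1 and G 1 = 12.
  boundary₀ : ∀ n → W n 0 ≡ 0ℤ
  boundary₀ n rewrite nC1≡n (suc n) | nC1≡n (suc n ℕ.+ 1) = evaluate (+ n) ((- (+ 16)) ^ n)
    where
    evaluate : ∀ N Q → let q = - (+ 16) in
      (- (+ 256 * (1ℤ + N) * (1ℤ + N) * (1ℤ + N) * (+ 1 * + 1 * Q)
          + - (+ 8 * (+ 2 * N + + 3) * (+ 2 * N * N + + 6 * N + + 5)) * (+ 1 * + 1 * (q * Q))
          + (+ 2 + N) * (+ 2 + N) * (+ 2 + N) * (+ 1 * + 1 * (q * (q * Q))))
        + + 512 * (+ 2 * N + + 3) * (1ℤ + + 0) * (1ℤ + + 0) * ((1ℤ + N) * (1ℤ + N + 1ℤ) * Q)) * + 1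
      + - (+ 2 * (+ 2 * N + + 3) * (1ℤ + + 0) * (1ℤ + + 0)) * (+ 1 * + 1 * (q * Q)) * + 12 ≡ 0ℤ
    evaluate = solve-∀

  boundary₁ : ∀ n → W n (3 ℕ.+ n) ≡ 0ℤ
  boundary₁ n = vanish (p₀ n) (p₁ n) (p₂ n) (r n K) (m n K) (G K) (G (suc K))
                       (triangle-above tTerm (ℕP.m<n⇒m<1+n (ℕP.m<n⇒m<1+n (ℕP.n<1+n n))))
                       (triangle-above tTerm (ℕP.m<n⇒m<1+n (ℕP.n<1+n (suc n))))
                       (triangle-above tTerm (ℕP.n<1+n (2 ℕ.+ n)))
                       (triangle-above tTerm (ℕP.m<n⇒m<1+n (ℕP.m<n⇒m<1+n (ℕP.n<1+n (suc n)))))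
    where
    K = 3 ℕ.+ n
    vanish : ∀ a b c d e g h {x₀ x₁ x₂ x₃} → x₀ ≡ 0ℤ → x₁ ≡ 0ℤ → x₂ ≡ 0ℤ → x₃ ≡ 0ℤ →
      (- (a * x₀ + b * x₁ + c * x₂) + d * x₃) * g + e * x₁ * h ≡ 0ℤ
    vanish a b c d e g h refl refl refl refl = at-zero a b c d e g h
      where
      at-zero : ∀ a b c d e g h → (- (a * 0ℤ + b * 0ℤ + c * 0ℤ) + d * 0ℤ) * g + e * 0ℤ * h ≡ 0ℤ
      at-zero = solve-∀

  F : ℕ → ℕ → ℤ
  F n k = T n k * G k

  RHS≡sumBelow : ∀ n → RHS n ≡ sumBelow (suc n) (F n)
  RHS≡sumBelow n = trans (sumTo≡sumBelow n _)
    (sumBelow-cong (suc n) λ k k<1+n → cong (_* G k) (sym (T≡ (ℕP.≤-pred k<1+n))))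
    where
    T≡ : ∀ {k} → k ℕ.≤ n → T n k ≡ + (n C k) * + ((n ℕ.+ k) C k) * (- (+ 16)) ^ (n ∸ k)
    T≡ {k} k≤n = trans (triangle-≤ tTerm k≤n)
      (cong (λ j → + (j C k) * + ((j ℕ.+ k) C k) * (- (+ 16)) ^ (n ∸ k)) (ℕP.m+[n∸m]≡n k≤n))

  annihilated : PV Annihilates RHS
  annihilated = annihilates-resp PV (λ n → sym (RHS≡sumBelow n))
    (annihilates-sum PV F (λ n k n<k → trans (cong (_* G k) (triangle-above tTerm n<k)) (ℤP.*-zeroˡ (G k))) vanishing)
    where
    factor : ∀ a b c x y z g → a * (x * g) + b * (y * g) + c * (z * g) ≡ (a * x + b * y + c * z) * g
    factor = solve-∀
    g₂≢0 : ∀ k → g₂ k ≢ 0ℤ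
    g₂≢0 k = *-≢0 (+[1+n]≢0 (suc k)) (+[1+n]≢0 (suc k))
    vanishing : ∀ n → sumBelow (3 ℕ.+ n) (λ k → p₀ n * F n k + p₁ n * F (suc n) k + p₂ n * F (2 ℕ.+ n) k) ≡ 0ℤ
    vanishing n = begin
      sumBelow K (λ k → p₀ n * F n k + p₁ n * F (suc n) k + p₂ n * F (2 ℕ.+ n) k)
        ≡⟨ sumBelow-cong K (λ k _ → factor (p₀ n) (p₁ n) (p₂ n) (T n k) (T (suc n) k) (T (2 ℕ.+ n) k) (G k)) ⟩
      sumBelow K (λ k → s n k * G k)
        ≡⟨ sumBelow-telescope (W n) (λ k → s n k * G k)
             (telescoping-against PG G-annihilated g₂≢0 (w₀ n) (w₁ n) (s n) (coefficient₀ n) (coefficient₁ n)) K ⟩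
      W n K - W n 0
        ≡⟨ cong₂ _-_ (boundary₁ n) (boundary₀ n) ⟩
      0ℤ ∎
      where K = 3 ℕ.+ n

theorem3p1 : (n : ℕ) → V n ≡ RHS n
theorem3p1 = annihilated-unique PV p₂≢0 V-annihilated RightHandSide.annihilated refl refl
  where
  p₂≢0 : ∀ n → Recurrence.p₂ PV n ≢ 0ℤ
  p₂≢0 n = *-≢0 (*-≢0 (+[1+n]≢0 (suc n)) (+[1+n]≢0 (suc n))) (+[1+n]≢0 (suc n))
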